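{- The family of finite semimodular vi-lattices is 2-summable.
   Context: A finite lattice is semimodular if whenever $a,b$ both cover $a\wedge b$, then $a\vee b$ covers both $a$ and $b$ (such lattices are graded). A vi-lattice is a lattice that is not a vertical sum (top of one identified with the bottom of the other) of two non-singleton lattices. Vertical 2-sum: for disjoint finite lattices $L,U$ of length at least 3, $L$ with exactly two coatoms $c_1,c_2$ and $U$ with exactly two atoms $a_1,a_2$, the two vertical 2-sums are obtained by removing the top of $L$ and the bottom of $U$ and identifying $(c_1,c_2)$ with $(a_1,a_2)$ or with $(a_2,a_1)$. A family $\mathcal{F}$ of graded vi-lattices is 2-summable if (C1) whenever $L,U\in\mathcal{F}$ and $S$ is one of their vertical 2-sums, $S\in\mathcal{F}$; and (C2) whenever $S\in\mathcal{F}$ is a vertical 2-sum of $L$ and $U$, then $L,U\in\mathcal{F}$. -}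

module Defs where

open import Level using (0ℓ)
open import Data.Nat using (ℕ)
open import Data.Fin using (Fin)
open import Data.Product using (Σ; Σ-syntax; _×_)
open import Data.Sum using (_⊎_)
open import Relation.Nullary using (¬_)
open import Relation.Binary.Core using (Rel)
open import Relation.Binary.PropositionalEquality using (_≡_; _≢_)
open import Algebra.Core using (Op₂)
open import Function.Bundles using (_⇔_)
open import Relation.Binary.Lattice.Structures using (IsLattice)

record FinLattice : Set₁ where
  field
    size      : ℕ
    _≤_       : Rel (Fin size) 0ℓ
    _∨_       : Op₂ (Fin size)
    _∧_       : Op₂ (Fin size)
    isLattice : IsLattice _≡_ _≤_ _∨_ _∧_
    inhabited : Fin size

module _ (L : FinLattice) where
  open FinLattice L

  Elt : Set
  Elt = Fin size

  _<_ : Elt → Elt → Set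
  x < y = (x ≤ y) × (x ≢ y)

  _⋖_ : Elt → Elt → Set
  x ⋖ y = (x < y) × (∀ z → x ≤ z → z ≤ y → (z ≡ x) ⊎ (z ≡ y))

  IsBottom : Elt → Set
  IsBottom b = ∀ y → b ≤ y

  IsTop : Elt → Set
  IsTop t = ∀ y → y ≤ t

  IsAtom : Elt → Set
  IsAtom a = Σ[ b ∈ Elt ] (IsBottom b × (b ⋖ a))

  IsCoatom : Elt → Set
  IsCoatom c = Σ[ t ∈ Elt ] (IsTop t × (c ⋖ t))

  ExactlyTwoAtoms : Elt → Elt → Set
  ExactlyTwoAtoms a₁ a₂ =
    (a₁ ≢ a₂) × IsAtom a₁ × IsAtom a₂ × (∀ a → IsAtom a → (a ≡ a₁) ⊎ (a ≡ a₂))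

  ExactlyTwoCoatoms : Elt → Elt → Set
  ExactlyTwoCoatoms c₁ c₂ =
    (c₁ ≢ c₂) × IsCoatom c₁ × IsCoatom c₂ × (∀ c → IsCoatom c → (c ≡ c₁) ⊎ (c ≡ c₂))

  LengthAtLeast3 : Set
  LengthAtLeast3 = Σ[ x₀ ∈ Elt ] Σ[ x₁ ∈ Elt ] Σ[ x₂ ∈ Elt ] Σ[ x₃ ∈ Elt ]
    ((x₀ < x₁) × (x₁ < x₂) × (x₂ < x₃))

  Semimodular : Set
  Semimodular = ∀ a b → (a ∧ b) ⋖ a → (a ∧ b) ⋖ b → (a ⋖ (a ∨ b)) × (b ⋖ (a ∨ b))

  NonSingleton : Set
  NonSingleton = Σ[ x ∈ Elt ] Σ[ y ∈ Elt ] (x ≢ y)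

record VerticalSumVia (L A B : FinLattice)
       (f : Elt A → Elt L) (g : Elt B → Elt L) : Set where
  private
    module L = FinLattice L
    module A = FinLattice A
    module B = FinLattice B
  field
    f-embed : ∀ x y → (x A.≤ y) ⇔ (f x L.≤ f y)
    g-embed : ∀ x y → (x B.≤ y) ⇔ (g x L.≤ g y)
    glue    : ∀ t b → IsTop A t → IsBottom B b → f t ≡ g b
    below   : ∀ x y → f x L.≤ g y
    cover   : ∀ z → (Σ[ x ∈ Elt A ] (f x ≡ z)) ⊎ (Σ[ y ∈ Elt B ] (g y ≡ z))

IsVerticalSum : FinLattice → FinLattice → FinLattice → Set
IsVerticalSum L A B =
  Σ[ f ∈ (Elt A → Elt L) ] Σ[ g ∈ (Elt B → Elt L) ] VerticalSumVia L A B f g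

IsVI : FinLattice → Set₁
IsVI L = ¬ (Σ[ A ∈ FinLattice ] Σ[ B ∈ FinLattice ]
             (NonSingleton A × NonSingleton B × IsVerticalSum L A B))

-- S is the vertical 2-sum of L and U obtained by removing the top of L and
-- the bottom of U and identifying c₁ with a₁ and c₂ with a₂; f and g
-- embed L ∖ {1_L} and U ∖ {0_U} into S (values of f at the top of L and
-- of g at the bottom of U are irrelevant).
record Vertical2SumVia (S L U : FinLattice)
       (c₁ c₂ : Elt L) (a₁ a₂ : Elt U)
       (f : Elt L → Elt S) (g : Elt U → Elt S) : Set where
  private
    module S = FinLattice S
    module L = FinLattice L
    module U = FinLattice U
  field
    L-length  : LengthAtLeast3 L
    U-length  : LengthAtLeast3 U
    L-coatoms : ExactlyTwoCoatoms L c₁ c₂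
    U-atoms   : ExactlyTwoAtoms U a₁ a₂
    f-embed   : ∀ x y → ¬ IsTop L x → ¬ IsTop L y → (x L.≤ y) ⇔ (f x S.≤ f y)
    g-embed   : ∀ x y → ¬ IsBottom U x → ¬ IsBottom U y → (x U.≤ y) ⇔ (g x S.≤ g y)
    glue₁     : f c₁ ≡ g a₁
    glue₂     : f c₂ ≡ g a₂
    f≤g       : ∀ x y → ¬ IsTop L x → ¬ IsBottom U y →
                (f x S.≤ g y) ⇔ (((x L.≤ c₁) × (a₁ U.≤ y)) ⊎ ((x L.≤ c₂) × (a₂ U.≤ y)))
    g≤f       : ∀ x y → ¬ IsTop L x → ¬ IsBottom U y →
                (g y S.≤ f x) ⇔ (((y ≡ a₁) × (c₁ L.≤ x)) ⊎ ((y ≡ a₂) × (c₂ L.≤ x)))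
    cover     : ∀ z → (Σ[ x ∈ Elt L ] (¬ IsTop L x × (f x ≡ z)))
                    ⊎ (Σ[ y ∈ Elt U ] (¬ IsBottom U y × (g y ≡ z)))

-- S is (isomorphic to) one of the two vertical 2-sums of L and U
-- (the two identifications are covered by the choice of labels a₁, a₂).
IsVertical2Sum : FinLattice → FinLattice → FinLattice → Set
IsVertical2Sum S L U =
  Σ[ c₁ ∈ Elt L ] Σ[ c₂ ∈ Elt L ] Σ[ a₁ ∈ Elt U ] Σ[ a₂ ∈ Elt U ]
  Σ[ f ∈ (Elt L → Elt S) ] Σ[ g ∈ (Elt U → Elt S) ]
    Vertical2SumVia S L U c₁ c₂ a₁ a₂ f g

TwoSummable : (FinLattice → Set₁) → Set₁
TwoSummable 𝓕 =
  (∀ L U S → 𝓕 L → 𝓕 U → IsVertical2Sum S L U → 𝓕 S)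
  × (∀ S L U → 𝓕 S → IsVertical2Sum S L U → 𝓕 L × 𝓕 U)

SemimodularVI : FinLattice → Set₁
SemimodularVI L = Semimodular L × IsVI L

-- A finite lattice is a vi-lattice exactly when it has no cut point, an element other than
-- 0 and 1 that is comparable with every element: the down-set and the up-set of a cut point
-- form a vertical sum. In a vertical 2-sum S of L and U, the copies of L ∖ {1} and U ∖ {0}
-- are a down-set and an up-set of S meeting in the glued elements c₁ = a₁ and c₂ = a₂, and
-- the embeddings preserve and reflect order, covers, and the meets and joins that stay
-- inside them. Hence cut points of S correspond to cut points of L or U, and a covering
-- configuration a ∧ b ⋖ a, b of S either lies in one part, where semimodularity transfers
-- directly, or can be pushed through the glued elements to the pair c₁, c₂, whose covering
-- of c₁ ∨ c₂ in S is equivalent to a₁, a₂ covering a₁ ∨ a₂ in U.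

{-# OPTIONS --safe #-}
module Submission where

open import Level using (0ℓ)
open import Data.Fin using (Fin; zero; suc; _≟_)
open import Data.Fin.Induction using (po-wellFounded)
open import Data.Fin.Properties using (any?)
open import Data.Product using (Σ; Σ-syntax; _×_; _,_; proj₁; proj₂; uncurry)
open import Data.Sum using (_⊎_; inj₁; inj₂)
import Data.Sum
open import Data.List using (List; _∷_; foldr; allFin; filter; length; lookup)
import Data.List.Relation.Unary.All as All
open import Data.List.Relation.Unary.AllPairs using (_∷_)
open import Data.List.Relation.Unary.Any.Properties using (lookup-index)
open import Data.List.Relation.Unary.Unique.Propositional using (Unique)
open import Data.List.Relation.Unary.Unique.Propositional.Properties using (allFin⁺; filter⁺)
open import Algebra.Core using (Op₂)
open import Data.List.Relation.Unary.Any using (here; there; index)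
open import Data.List.Membership.Propositional using (_∈_)
open import Data.List.Membership.Propositional.Properties using (∈-allFin; ∈-lookup; ∈-filter⁺; ∈-filter⁻)
open import Data.Empty using (⊥; ⊥-elim)
open import Function.Base using (flip; _∘_; id)
open import Function.Bundles using (mk⇔; module Equivalence)
open Equivalence using (to; from)
open import Induction.WellFounded using (WellFounded; Acc; acc)
open import Relation.Nullary using (¬_; Dec; yes; no)
open import Relation.Nullary.Decidable using (_×-dec_; ¬?; map′)
open import Relation.Binary.PropositionalEquality
  using (_≡_; _≢_; refl; sym; trans; cong; cong₂; subst; subst₂; isEquivalence)
open import Relation.Binary.Lattice using (Lattice; IsLattice)
import Relation.Binary.Lattice.Properties.Lattice as LatticeProperties
import Relation.Binary.Lattice.Properties.MeetSemilattice as MeetProperties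
import Relation.Binary.Lattice.Properties.JoinSemilattice as JoinProperties
open import Defs hiding (_<_; _⋖_)

module FinLatticeBasics (K : FinLattice) where
  open FinLattice K public
  open IsLattice isLattice public
    using (antisym; x≤x∨y; y≤x∨y; ∨-least; x∧y≤x; x∧y≤y; ∧-greatest; isPartialOrder)
    renaming (refl to ≤-refl; trans to ≤-trans; reflexive to ≤-reflexive)

  infix 4 _<_ _⋖_
  _<_ : Elt K → Elt K → Set
  _<_ = Defs._<_ K

  _⋖_ : Elt K → Elt K → Set
  _⋖_ = Defs._⋖_ K

  lattice : Lattice 0ℓ 0ℓ 0ℓ
  lattice = record { isLattice = isLattice }

  open MeetProperties (Lattice.meetSemilattice lattice) public
    using (∧-comm; ≈-dec⇒≤-dec)
  open JoinProperties (Lattice.joinSemilattice lattice) public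
    using (∨-comm)

  _≤?_ : ∀ x y → Dec (x ≤ y)
  _≤?_ = ≈-dec⇒≤-dec _≟_

  _<?_ : ∀ x y → Dec (x < y)
  x <? y = (x ≤? y) ×-dec ¬? (x ≟ y)

  <-wellFounded : WellFounded _<_
  <-wellFounded = po-wellFounded isPartialOrder

  cover-between : ∀ {m x} → m < x → Σ[ u ∈ Elt K ] (m ⋖ u × u ≤ x)
  cover-between {m} {x} = go x (<-wellFounded x)
    where
    go : ∀ x → Acc _<_ x → m < x → Σ[ u ∈ Elt K ] (m ⋖ u × u ≤ x)
    go x (acc rec) m<x with any? (λ z → (m <? z) ×-dec (z <? x))
    ... | yes (z , m<z , z<x) =
      let u , m⋖u , u≤z = go z (rec z<x) m<z in u , m⋖u , ≤-trans u≤z (proj₁ z<x)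
    ... | no ∄z = x , (m<x , nothing-between) , ≤-refl
      where
      nothing-between : ∀ z → m ≤ z → z ≤ x → z ≡ m ⊎ z ≡ x
      nothing-between z m≤z z≤x with z ≟ m | z ≟ x
      ... | yes z≡m | _       = inj₁ z≡m
      ... | no _    | yes z≡x = inj₂ z≡x
      ... | no z≢m  | no z≢x  = ⊥-elim (∄z (z , (m≤z , z≢m ∘ sym) , (z≤x , z≢x)))

  lub⇒≡∨ : ∀ {x y j} → x ≤ j → y ≤ j → (∀ u → x ≤ u → y ≤ u → j ≤ u) → x ∨ y ≡ j
  lub⇒≡∨ x≤j y≤j least = antisym (∨-least x≤j y≤j) (least _ (x≤x∨y _ _) (y≤x∨y _ _))

  glb⇒≡∧ : ∀ {x y m} → m ≤ x → m ≤ y → (∀ u → u ≤ x → u ≤ y → u ≤ m) → x ∧ y ≡ m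
  glb⇒≡∧ m≤x m≤y greatest = antisym (greatest _ (x∧y≤x _ _) (x∧y≤y _ _)) (∧-greatest m≤x m≤y)

  ⋖-meetˡ⇒≰ : ∀ {a b} → (a ∧ b) ⋖ a → ¬ a ≤ b
  ⋖-meetˡ⇒≰ {a} {b} ((_ , a∧b≢a) , _) a≤b =
    a∧b≢a (antisym (x∧y≤x a b) (∧-greatest ≤-refl a≤b))

  ⋖-meetʳ⇒≰ : ∀ {a b} → (a ∧ b) ⋖ b → ¬ b ≤ a
  ⋖-meetʳ⇒≰ {a} {b} ((_ , a∧b≢b) , _) b≤a =
    a∧b≢b (antisym (x∧y≤y a b) (∧-greatest b≤a ≤-refl))

  top : Σ[ t ∈ Elt K ] IsTop K t
  top = ⋁ (allFin size) , λ y → ⋁-upper (∈-allFin y)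
    where
    ⋁ : List (Elt K) → Elt K
    ⋁ = foldr _∨_ inhabited

    ⋁-upper : ∀ {x xs} → x ∈ xs → x ≤ ⋁ xs
    ⋁-upper {xs = y ∷ ys} (here refl) = x≤x∨y y (⋁ ys)
    ⋁-upper {xs = y ∷ ys} (there x∈ys) = ≤-trans (⋁-upper x∈ys) (y≤x∨y y (⋁ ys))

dual : FinLattice → FinLattice
dual K = record
  { size      = size
  ; _≤_       = flip _≤_
  ; _∨_       = _∧_
  ; _∧_       = _∨_
  ; isLattice = LatticeProperties.∧-∨-isLattice lattice
  ; inhabited = inhabited
  }
  where open FinLatticeBasics K

module FinLatticeProperties (K : FinLattice) where
  open FinLatticeBasics K public
  private module Kᵒ = FinLatticeBasics (dual K)

  bottom : Σ[ b ∈ Elt K ] IsBottom K b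
  bottom = Kᵒ.top

  cover-below : ∀ {x t} → x < t → Σ[ u ∈ Elt K ] (x ≤ u × u ⋖ t)
  cover-below (x≤t , x≢t) with Kᵒ.cover-between (x≤t , x≢t ∘ sym)
  ... | u , ((u≤t , t≢u) , between) , x≤u = u , x≤u , (u≤t , t≢u ∘ sym) , between′
    where
    between′ : ∀ z → u ≤ z → z ≤ _ → z ≡ u ⊎ z ≡ _
    between′ z u≤z z≤t = Data.Sum.swap (between z z≤t u≤z)

  𝟙 : Elt K
  𝟙 = proj₁ top

  𝟘 : Elt K
  𝟘 = proj₁ bottom

  IsTop⇒≡𝟙 : ∀ {t} → IsTop K t → t ≡ 𝟙
  IsTop⇒≡𝟙 t-top = antisym (proj₂ top _) (t-top 𝟙)

  IsBottom⇒≡𝟘 : ∀ {b} → IsBottom K b → b ≡ 𝟘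
  IsBottom⇒≡𝟘 b-bottom = antisym (b-bottom 𝟘) (proj₂ bottom _)

  IsTop? : ∀ x → Dec (IsTop K x)
  IsTop? x = map′ (λ { refl → proj₂ top }) IsTop⇒≡𝟙 (x ≟ 𝟙)

  IsBottom? : ∀ x → Dec (IsBottom K x)
  IsBottom? x = map′ (λ { refl → proj₂ bottom }) IsBottom⇒≡𝟘 (x ≟ 𝟘)

  ¬IsTop⇒<𝟙 : ∀ {x} → ¬ IsTop K x → x < 𝟙
  ¬IsTop⇒<𝟙 x-not-top = proj₂ top _ , λ { refl → x-not-top (proj₂ top) }

  ¬IsBottom⇒𝟘< : ∀ {x} → ¬ IsBottom K x → 𝟘 < x
  ¬IsBottom⇒𝟘< x-not-bottom = proj₂ bottom _ , λ { refl → x-not-bottom (proj₂ bottom) }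

  coatom-⋖-top : ∀ {c t} → IsCoatom K c → IsTop K t → c ⋖ t
  coatom-⋖-top {c} (t′ , t′-top , c⋖t′) t-top = subst (c ⋖_) (antisym (t-top t′) (t′-top _)) c⋖t′

  coatom-¬top : ∀ {c} → IsCoatom K c → ¬ IsTop K c
  coatom-¬top (t , _ , (c≤t , c≢t) , _) c-top = c≢t (antisym c≤t (c-top t))

  atom-¬bottom : ∀ {a} → IsAtom K a → ¬ IsBottom K a
  atom-¬bottom (b , _ , (b≤a , b≢a) , _) a-bottom = b≢a (antisym b≤a (a-bottom b))

  coatom-maximal : ∀ {c x} → IsCoatom K c → ¬ IsTop K x → c ≤ x → x ≡ c
  coatom-maximal (t , t-top , _ , between) x-not-top c≤x with between _ c≤x (t-top _)
  ... | inj₁ x≡c  = x≡c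
  ... | inj₂ refl = ⊥-elim (x-not-top t-top)

  atom-minimal : ∀ {a x} → IsAtom K a → ¬ IsBottom K x → x ≤ a → x ≡ a
  atom-minimal (b , b-bottom , _ , between) x-not-bottom x≤a with between _ (b-bottom _) x≤a
  ... | inj₁ refl = ⊥-elim (x-not-bottom b-bottom)
  ... | inj₂ x≡a  = x≡a

  below-coatom : ∀ {x} → ¬ IsTop K x → Σ[ c ∈ Elt K ] (IsCoatom K c × x ≤ c)
  below-coatom x-not-top =
    let c , x≤c , c⋖𝟙 = cover-below (¬IsTop⇒<𝟙 x-not-top) in
    c , (𝟙 , proj₂ top , c⋖𝟙) , x≤c

  above-atom : ∀ {x} → ¬ IsBottom K x → Σ[ a ∈ Elt K ] (IsAtom K a × a ≤ x)
  above-atom x-not-bottom =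
    let a , 𝟘⋖a , a≤x = cover-between (¬IsBottom⇒𝟘< x-not-bottom) in
    a , (𝟘 , proj₂ bottom , 𝟘⋖a) , a≤x

  coatoms-incomparable : ∀ {c c′} → c ≢ c′ → IsCoatom K c → IsCoatom K c′ → ¬ c ≤ c′
  coatoms-incomparable c≢c′ c-coatom c′-coatom c≤c′ =
    c≢c′ (sym (coatom-maximal c-coatom (coatom-¬top c′-coatom) c≤c′))

  atoms-incomparable : ∀ {a a′} → a ≢ a′ → IsAtom K a → IsAtom K a′ → ¬ a ≤ a′
  atoms-incomparable a≢a′ a-atom a′-atom a≤a′ =
    a≢a′ (atom-minimal a′-atom (atom-¬bottom a-atom) a≤a′)

  meet-of-atoms-⋖ : ∀ {a a′} → a ≢ a′ → IsAtom K a → IsAtom K a′ → (a ∧ a′) ⋖ a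
  meet-of-atoms-⋖ {a} {a′} a≢a′ a-atom@(b , b-bottom , b⋖a@(_ , between)) a′-atom
    with between (a ∧ a′) (b-bottom _) (x∧y≤x a a′)
  ... | inj₁ a∧a′≡b = subst (_⋖ a) (sym a∧a′≡b) b⋖a
  ... | inj₂ a∧a′≡a =
    ⊥-elim (atoms-incomparable a≢a′ a-atom a′-atom (subst (_≤ a′) a∧a′≡a (x∧y≤y a a′)))

lookup-injective : ∀ {A : Set} {xs : List A} → Unique xs →
                   ∀ {i j} → lookup xs i ≡ lookup xs j → i ≡ j
lookup-injective {xs = _ ∷ _} _             {zero}  {zero}  _ = refl
lookup-injective             (x∉xs ∷ _)     {zero}  {suc j} e = ⊥-elim (All.lookup x∉xs (∈-lookup j) e)
lookup-injective             (x∉xs ∷ _)     {suc i} {zero}  e = ⊥-elim (All.lookup x∉xs (∈-lookup i) (sym e))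
lookup-injective             (_ ∷ xs-unique) {suc i} {suc j} e = cong suc (lookup-injective xs-unique e)

module Sublattice (K : FinLattice)
                  (P : Elt K → Set) (P? : ∀ x → Dec (P x))
                  (∨-closed : ∀ {x y} → P x → P y → P (FinLattice._∨_ K x y))
                  (∧-closed : ∀ {x y} → P x → P y → P (FinLattice._∧_ K x y))
                  {w : Elt K} (Pw : P w) where
  open FinLatticeProperties K
  private
    members : List (Elt K)
    members = filter P? (allFin size)

  ι : Fin (length members) → Elt K
  ι = lookup members

  ι-injective : ∀ {i j} → ι i ≡ ι j → i ≡ j
  ι-injective = lookup-injective (filter⁺ P? (allFin⁺ size))

  ι-member : ∀ i → P (ι i)
  ι-member i = proj₂ (∈-filter⁻ P? {xs = allFin size} (∈-lookup i))

  preimage : ∀ {z} → P z → Fin (length members)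
  preimage Pz = index (∈-filter⁺ P? (∈-allFin _) Pz)

  ι-preimage : ∀ {z} (Pz : P z) → ι (preimage Pz) ≡ z
  ι-preimage Pz = sym (lookup-index (∈-filter⁺ P? (∈-allFin _) Pz))

  private
    _∨ˢ_ _∧ˢ_ : Op₂ (Fin (length members))
    i ∨ˢ j = preimage (∨-closed (ι-member i) (ι-member j))
    i ∧ˢ j = preimage (∧-closed (ι-member i) (ι-member j))

    ι-∨ : ∀ i j → ι (i ∨ˢ j) ≡ ι i ∨ ι j
    ι-∨ i j = ι-preimage (∨-closed (ι-member i) (ι-member j))

    ι-∧ : ∀ i j → ι (i ∧ˢ j) ≡ ι i ∧ ι j
    ι-∧ i j = ι-preimage (∧-closed (ι-member i) (ι-member j))

  sublattice : FinLattice
  sublattice = record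
    { size      = length members
    ; _≤_       = λ i j → ι i ≤ ι j
    ; _∨_       = _∨ˢ_
    ; _∧_       = _∧ˢ_
    ; isLattice = record
      { isPartialOrder = record
        { isPreorder = record
          { isEquivalence = isEquivalence
          ; reflexive     = λ { refl → ≤-refl }
          ; trans         = ≤-trans
          }
        ; antisym = λ i≤j j≤i → ι-injective (antisym i≤j j≤i)
        }
      ; supremum = λ i j → subst (λ s → ι i ≤ s × ι j ≤ s × (∀ k → ι i ≤ ι k → ι j ≤ ι k → s ≤ ι k))
                                 (sym (ι-∨ i j)) (x≤x∨y _ _ , y≤x∨y _ _ , λ _ → ∨-least)
      ; infimum  = λ i j → subst (λ s → s ≤ ι i × s ≤ ι j × (∀ k → ι k ≤ ι i → ι k ≤ ι j → ι k ≤ s))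
                                 (sym (ι-∧ i j)) (x∧y≤x _ _ , x∧y≤y _ _ , λ _ → ∧-greatest)
      }
    ; inhabited = preimage Pw
    }

record IsCutPoint (K : FinLattice) (p : Elt K) : Set where
  private module K = FinLatticeBasics K
  field
    comparable : ∀ z → z K.≤ p ⊎ p K.≤ z
    lower      : Σ[ z ∈ Elt K ] z K.< p
    upper      : Σ[ z ∈ Elt K ] p K.< z

module _ {K : FinLattice} {p : Elt K} (cut : IsCutPoint K p) where
  open FinLatticeProperties K
  open IsCutPoint cut

  cutPoint-¬top : ¬ IsTop K p
  cutPoint-¬top p-top = let z , p≤z , p≢z = upper in p≢z (antisym p≤z (p-top z))

  cutPoint-¬bottom : ¬ IsBottom K p
  cutPoint-¬bottom p-bottom = let z , z≤p , z≢p = lower in z≢p (antisym z≤p (p-bottom z))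

  cutPoint-below-coatom : ∀ {c c′} → c ≢ c′ → IsCoatom K c → IsCoatom K c′ → p ≤ c
  cutPoint-below-coatom {c} {c′} c≢c′ c-coatom c′-coatom with comparable c
  ... | inj₂ p≤c = p≤c
  ... | inj₁ c≤p with coatom-maximal c-coatom cutPoint-¬top c≤p
  ...   | refl = ⊥-elim (Data.Sum.[ coatoms-incomparable (c≢c′ ∘ sym) c′-coatom c-coatom
                                  , coatoms-incomparable c≢c′ c-coatom c′-coatom ] (comparable c′))

  cutPoint-above-atom : ∀ {a a′} → a ≢ a′ → IsAtom K a → IsAtom K a′ → a ≤ p
  cutPoint-above-atom {a} {a′} a≢a′ a-atom a′-atom with comparable a
  ... | inj₁ a≤p = a≤p
  ... | inj₂ p≤a with atom-minimal a-atom cutPoint-¬bottom p≤a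
  ...   | refl = ⊥-elim (Data.Sum.[ atoms-incomparable (a≢a′ ∘ sym) a′-atom a-atom
                                  , atoms-incomparable a≢a′ a-atom a′-atom ] (comparable a′))

module _ {K : FinLattice} where
  open FinLatticeProperties K

  ¬cutPoint⇒IsVI : (∀ p → ¬ IsCutPoint K p) → IsVI K
  ¬cutPoint⇒IsVI no-cut (A , B , (a , a′ , a≢a′) , (b , b′ , b≢b′) , f , g , sum) =
    no-cut (f ⊤ᴬ) record
      { comparable = comparable
      ; lower      = let x , x≢⊤ = other-than ⊤ᴬ a≢a′ in
                     f x , to (f-embed x ⊤ᴬ) (⊤ᴬ-top x) , x≢⊤ ∘ f-injective
      ; upper      = let y , y≢⊥ = other-than ⊥ᴮ b≢b′ in
                     g y , below ⊤ᴬ y ,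
                     λ e → y≢⊥ (g-injective (trans (sym e) (glue ⊤ᴬ ⊥ᴮ ⊤ᴬ-top ⊥ᴮ-bottom)))
      }
    where
    open VerticalSumVia sum
    module A = FinLatticeProperties A
    module B = FinLatticeProperties B
    ⊤ᴬ = proj₁ A.top
    ⊤ᴬ-top = proj₂ A.top
    ⊥ᴮ = proj₁ B.bottom
    ⊥ᴮ-bottom = proj₂ B.bottom

    f-injective : ∀ {x y} → f x ≡ f y → x ≡ y
    f-injective {x} {y} e =
      A.antisym (from (f-embed x y) (≤-reflexive e)) (from (f-embed y x) (≤-reflexive (sym e)))

    g-injective : ∀ {x y} → g x ≡ g y → x ≡ y
    g-injective {x} {y} e =
      B.antisym (from (g-embed x y) (≤-reflexive e)) (from (g-embed y x) (≤-reflexive (sym e)))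

    other-than : ∀ {n} (t : Fin n) {x y : Fin n} → x ≢ y → Σ[ z ∈ Fin n ] z ≢ t
    other-than t {x} {y} x≢y with x ≟ t
    ... | yes x≡t = y , λ y≡t → x≢y (trans x≡t (sym y≡t))
    ... | no x≢t  = x , x≢t

    comparable : ∀ z → z ≤ f ⊤ᴬ ⊎ f ⊤ᴬ ≤ z
    comparable z with cover z
    ... | inj₁ (x , refl) = inj₁ (to (f-embed x ⊤ᴬ) (⊤ᴬ-top x))
    ... | inj₂ (y , refl) = inj₂ (below ⊤ᴬ y)

  IsVI⇒¬cutPoint : IsVI K → ∀ p → ¬ IsCutPoint K p
  IsVI⇒¬cutPoint vi p cut =
    vi (Down.sublattice , Up.sublattice , nonSingleton-down , nonSingleton-up , Down.ι , Up.ι , sum)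
    where
    open IsCutPoint cut
    module Down = Sublattice K (_≤ p) (_≤? p) ∨-least (λ x≤p _ → ≤-trans (x∧y≤x _ _) x≤p) ≤-refl
    module Up = Sublattice K (p ≤_) (p ≤?_) (λ p≤x _ → ≤-trans p≤x (x≤x∨y _ _)) ∧-greatest ≤-refl

    nonSingleton-down : NonSingleton Down.sublattice
    nonSingleton-down =
      let z , z≤p , z≢p = lower in
      Down.preimage ≤-refl , Down.preimage z≤p ,
      λ e → z≢p (trans (sym (Down.ι-preimage z≤p))
                       (trans (cong Down.ι (sym e)) (Down.ι-preimage ≤-refl)))

    nonSingleton-up : NonSingleton Up.sublattice
    nonSingleton-up =
      let z , p≤z , p≢z = upper in
      Up.preimage ≤-refl , Up.preimage p≤z ,
      λ e → p≢z (trans (sym (Up.ι-preimage ≤-refl)) (trans (cong Up.ι e) (Up.ι-preimage p≤z)))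

    sum : VerticalSumVia K Down.sublattice Up.sublattice Down.ι Up.ι
    sum = record
      { f-embed = λ _ _ → mk⇔ id id
      ; g-embed = λ _ _ → mk⇔ id id
      ; glue    = λ t b t-top b-bottom →
          trans (antisym (Down.ι-member t) (subst (_≤ Down.ι t) (Down.ι-preimage ≤-refl) (t-top _)))
                (antisym (Up.ι-member b) (subst (Up.ι b ≤_) (Up.ι-preimage ≤-refl) (b-bottom _)))
      ; below   = λ x y → ≤-trans (Down.ι-member x) (Up.ι-member y)
      ; cover   = λ z → Data.Sum.map (λ z≤p → Down.preimage z≤p , Down.ι-preimage z≤p)
                                     (λ p≤z → Up.preimage p≤z , Up.ι-preimage p≤z) (comparable z)
      }

UpperCovering : FinLattice → Set
UpperCovering K = ∀ a b → (a ∧ b) ⋖ a → (a ∧ b) ⋖ b → a ⋖ (a ∨ b)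
  where open FinLatticeBasics K

module _ {K : FinLattice} where
  open FinLatticeBasics K

  upperCovering⇒semimodular : UpperCovering K → Semimodular K
  upperCovering⇒semimodular cov a b a∧b⋖a a∧b⋖b =
    cov a b a∧b⋖a a∧b⋖b ,
    subst (b ⋖_) (∨-comm b a)
      (cov b a (subst (_⋖ b) (∧-comm a b) a∧b⋖b) (subst (_⋖ a) (∧-comm a b) a∧b⋖a))

module Vertical2Sum {S L U : FinLattice} {c₁ c₂ : Elt L} {a₁ a₂ : Elt U}
                    {f : Elt L → Elt S} {g : Elt U → Elt S}
                    (V : Vertical2SumVia S L U c₁ c₂ a₁ a₂ f g) where
  open Vertical2SumVia V public
  module S = FinLatticeProperties S
  module L = FinLatticeProperties L
  module U = FinLatticeProperties U

  NotTop : Elt L → Set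
  NotTop x = ¬ IsTop L x

  NotBottom : Elt U → Set
  NotBottom y = ¬ IsBottom U y

  InF : Elt S → Set
  InF z = Σ[ x ∈ Elt L ] (NotTop x × f x ≡ z)

  InG : Elt S → Set
  InG z = Σ[ y ∈ Elt U ] (NotBottom y × g y ≡ z)

  c₁≢c₂ : c₁ ≢ c₂
  c₁≢c₂ = proj₁ L-coatoms

  c₁-coatom : IsCoatom L c₁
  c₁-coatom = proj₁ (proj₂ L-coatoms)

  c₂-coatom : IsCoatom L c₂
  c₂-coatom = proj₁ (proj₂ (proj₂ L-coatoms))

  coatom-cases : ∀ {c} → IsCoatom L c → c ≡ c₁ ⊎ c ≡ c₂
  coatom-cases = proj₂ (proj₂ (proj₂ L-coatoms)) _

  a₁≢a₂ : a₁ ≢ a₂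
  a₁≢a₂ = proj₁ U-atoms

  a₁-atom : IsAtom U a₁
  a₁-atom = proj₁ (proj₂ U-atoms)

  a₂-atom : IsAtom U a₂
  a₂-atom = proj₁ (proj₂ (proj₂ U-atoms))

  atom-cases : ∀ {a} → IsAtom U a → a ≡ a₁ ⊎ a ≡ a₂
  atom-cases = proj₂ (proj₂ (proj₂ U-atoms)) _

  c₁-NotTop : NotTop c₁
  c₁-NotTop = L.coatom-¬top c₁-coatom

  c₂-NotTop : NotTop c₂
  c₂-NotTop = L.coatom-¬top c₂-coatom

  a₁-NotBottom : NotBottom a₁
  a₁-NotBottom = U.atom-¬bottom a₁-atom

  a₂-NotBottom : NotBottom a₂
  a₂-NotBottom = U.atom-¬bottom a₂-atom

  NotTop-↓ : ∀ {x x′} → NotTop x′ → x L.≤ x′ → NotTop x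
  NotTop-↓ x′-not-top x≤x′ x-top = x′-not-top (λ z → L.≤-trans (x-top z) x≤x′)

  NotBottom-↑ : ∀ {y y′} → NotBottom y → y U.≤ y′ → NotBottom y′
  NotBottom-↑ y-not-bottom y≤y′ y′-bottom = y-not-bottom (λ z → U.≤-trans y≤y′ (y′-bottom z))

  below-c₁-or-c₂ : ∀ {x} → NotTop x → x L.≤ c₁ ⊎ x L.≤ c₂
  below-c₁-or-c₂ x-not-top with L.below-coatom x-not-top
  ... | c , c-coatom , x≤c with coatom-cases c-coatom
  ... | inj₁ refl = inj₁ x≤c
  ... | inj₂ refl = inj₂ x≤c

  above-a₁-or-a₂ : ∀ {y} → NotBottom y → a₁ U.≤ y ⊎ a₂ U.≤ y
  above-a₁-or-a₂ y-not-bottom with U.above-atom y-not-bottom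
  ... | a , a-atom , a≤y with atom-cases a-atom
  ... | inj₁ refl = inj₁ a≤y
  ... | inj₂ refl = inj₂ a≤y

  f-mono : ∀ {x x′} → NotTop x → NotTop x′ → x L.≤ x′ → f x S.≤ f x′
  f-mono x-nt x′-nt = to (f-embed _ _ x-nt x′-nt)

  f-reflect : ∀ {x x′} → NotTop x → NotTop x′ → f x S.≤ f x′ → x L.≤ x′
  f-reflect x-nt x′-nt = from (f-embed _ _ x-nt x′-nt)

  g-mono : ∀ {y y′} → NotBottom y → NotBottom y′ → y U.≤ y′ → g y S.≤ g y′
  g-mono y-nb y′-nb = to (g-embed _ _ y-nb y′-nb)

  g-reflect : ∀ {y y′} → NotBottom y → NotBottom y′ → g y S.≤ g y′ → y U.≤ y′
  g-reflect y-nb y′-nb = from (g-embed _ _ y-nb y′-nb)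

  f-injective : ∀ {x x′} → NotTop x → NotTop x′ → f x ≡ f x′ → x ≡ x′
  f-injective x-nt x′-nt e =
    L.antisym (f-reflect x-nt x′-nt (S.≤-reflexive e)) (f-reflect x′-nt x-nt (S.≤-reflexive (sym e)))

  g-injective : ∀ {y y′} → NotBottom y → NotBottom y′ → g y ≡ g y′ → y ≡ y′
  g-injective y-nb y′-nb e =
    U.antisym (g-reflect y-nb y′-nb (S.≤-reflexive e)) (g-reflect y′-nb y-nb (S.≤-reflexive (sym e)))

  f≤g-cases : ∀ {x y} → NotTop x → NotBottom y → f x S.≤ g y →
              (x L.≤ c₁ × a₁ U.≤ y) ⊎ (x L.≤ c₂ × a₂ U.≤ y)
  f≤g-cases x-nt y-nb = to (f≤g _ _ x-nt y-nb)

  f≤g-intro : ∀ {x y} → NotTop x → NotBottom y →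
              (x L.≤ c₁ × a₁ U.≤ y) ⊎ (x L.≤ c₂ × a₂ U.≤ y) → f x S.≤ g y
  f≤g-intro x-nt y-nb = from (f≤g _ _ x-nt y-nb)

  g≤f⇒≡ : ∀ {x y} → NotTop x → NotBottom y → g y S.≤ f x → g y ≡ f x
  g≤f⇒≡ x-nt y-nb gy≤fx with to (g≤f _ _ x-nt y-nb) gy≤fx
  ... | inj₁ (refl , c₁≤x) = trans (sym glue₁) (cong f (sym (L.coatom-maximal c₁-coatom x-nt c₁≤x)))
  ... | inj₂ (refl , c₂≤x) = trans (sym glue₂) (cong f (sym (L.coatom-maximal c₂-coatom x-nt c₂≤x)))

  InF-↓ : ∀ {z z′} → InF z → z′ S.≤ z → InF z′
  InF-↓ {z′ = z′} (x , x-nt , refl) z′≤fx with cover z′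
  ... | inj₁ z′∈F              = z′∈F
  ... | inj₂ (y , y-nb , refl) = x , x-nt , sym (g≤f⇒≡ x-nt y-nb z′≤fx)

  InG-↑ : ∀ {z z′} → InG z → z S.≤ z′ → InG z′
  InG-↑ {z′ = z′} (y , y-nb , refl) gy≤z′ with cover z′
  ... | inj₂ z′∈G              = z′∈G
  ... | inj₁ (x , x-nt , refl) = y , y-nb , g≤f⇒≡ x-nt y-nb gy≤z′

  f-preserves-⋖ : ∀ {x x′} → NotTop x → NotTop x′ → x L.⋖ x′ → f x S.⋖ f x′
  f-preserves-⋖ {x} {x′} x-nt x′-nt ((x≤x′ , x≢x′) , between) =
    (f-mono x-nt x′-nt x≤x′ , x≢x′ ∘ f-injective x-nt x′-nt) , between′
    where
    between′ : ∀ z → f x S.≤ z → z S.≤ f x′ → z ≡ f x ⊎ z ≡ f x′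
    between′ z fx≤z z≤fx′ with InF-↓ (x′ , x′-nt , refl) z≤fx′
    ... | w , w-nt , refl =
      Data.Sum.map (cong f) (cong f) (between w (f-reflect x-nt w-nt fx≤z) (f-reflect w-nt x′-nt z≤fx′))

  f-reflects-⋖ : ∀ {x x′} → NotTop x → NotTop x′ → f x S.⋖ f x′ → x L.⋖ x′
  f-reflects-⋖ {x} {x′} x-nt x′-nt ((fx≤fx′ , fx≢fx′) , between) =
    (f-reflect x-nt x′-nt fx≤fx′ , fx≢fx′ ∘ cong f) , between′
    where
    between′ : ∀ w → x L.≤ w → w L.≤ x′ → w ≡ x ⊎ w ≡ x′
    between′ w x≤w w≤x′ =
      let w-nt = NotTop-↓ x′-nt w≤x′ in
      Data.Sum.map (f-injective w-nt x-nt) (f-injective w-nt x′-nt)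
                   (between (f w) (f-mono x-nt w-nt x≤w) (f-mono w-nt x′-nt w≤x′))

  g-preserves-⋖ : ∀ {y y′} → NotBottom y → NotBottom y′ → y U.⋖ y′ → g y S.⋖ g y′
  g-preserves-⋖ {y} {y′} y-nb y′-nb ((y≤y′ , y≢y′) , between) =
    (g-mono y-nb y′-nb y≤y′ , y≢y′ ∘ g-injective y-nb y′-nb) , between′
    where
    between′ : ∀ z → g y S.≤ z → z S.≤ g y′ → z ≡ g y ⊎ z ≡ g y′
    between′ z gy≤z z≤gy′ with InG-↑ (y , y-nb , refl) gy≤z
    ... | v , v-nb , refl =
      Data.Sum.map (cong g) (cong g) (between v (g-reflect y-nb v-nb gy≤z) (g-reflect v-nb y′-nb z≤gy′))

  g-reflects-⋖ : ∀ {y y′} → NotBottom y → NotBottom y′ → g y S.⋖ g y′ → y U.⋖ y′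
  g-reflects-⋖ {y} {y′} y-nb y′-nb ((gy≤gy′ , gy≢gy′) , between) =
    (g-reflect y-nb y′-nb gy≤gy′ , gy≢gy′ ∘ cong g) , between′
    where
    between′ : ∀ v → y U.≤ v → v U.≤ y′ → v ≡ y ⊎ v ≡ y′
    between′ v y≤v v≤y′ =
      let v-nb = NotBottom-↑ y-nb y≤v in
      Data.Sum.map (g-injective v-nb y-nb) (g-injective v-nb y′-nb)
                   (between (g v) (g-mono y-nb v-nb y≤v) (g-mono v-nb y′-nb v≤y′))

  f-∧ : ∀ {x x′} → NotTop x → NotTop x′ → f x S.∧ f x′ ≡ f (x L.∧ x′)
  f-∧ {x} {x′} x-nt x′-nt =
    S.glb⇒≡∧ (f-mono m-nt x-nt (L.x∧y≤x x x′)) (f-mono m-nt x′-nt (L.x∧y≤y x x′)) greatest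
    where
    m-nt = NotTop-↓ x-nt (L.x∧y≤x x x′)
    greatest : ∀ u → u S.≤ f x → u S.≤ f x′ → u S.≤ f (x L.∧ x′)
    greatest u u≤fx u≤fx′ with InF-↓ (x , x-nt , refl) u≤fx
    ... | w , w-nt , refl = f-mono w-nt m-nt (L.∧-greatest (f-reflect w-nt x-nt u≤fx) (f-reflect w-nt x′-nt u≤fx′))

  g-∨ : ∀ {y y′} → NotBottom y → NotBottom y′ → g y S.∨ g y′ ≡ g (y U.∨ y′)
  g-∨ {y} {y′} y-nb y′-nb =
    S.lub⇒≡∨ (g-mono y-nb j-nb (U.x≤x∨y y y′)) (g-mono y′-nb j-nb (U.y≤x∨y y y′)) least
    where
    j-nb = NotBottom-↑ y-nb (U.x≤x∨y y y′)
    least : ∀ u → g y S.≤ u → g y′ S.≤ u → g (y U.∨ y′) S.≤ u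
    least u gy≤u gy′≤u with InG-↑ (y , y-nb , refl) gy≤u
    ... | v , v-nb , refl = g-mono j-nb v-nb (U.∨-least (g-reflect y-nb v-nb gy≤u) (g-reflect y′-nb v-nb gy′≤u))

  f-∨ : ∀ {x x′} → NotTop x → NotTop x′ → NotTop (x L.∨ x′) → f x S.∨ f x′ ≡ f (x L.∨ x′)
  f-∨ {x} {x′} x-nt x′-nt j-nt =
    S.lub⇒≡∨ (f-mono x-nt j-nt (L.x≤x∨y x x′)) (f-mono x′-nt j-nt (L.y≤x∨y x x′)) least
    where
    least : ∀ u → f x S.≤ u → f x′ S.≤ u → f (x L.∨ x′) S.≤ u
    least u fx≤u fx′≤u with cover u
    ... | inj₁ (w , w-nt , refl) =
      f-mono j-nt w-nt (L.∨-least (f-reflect x-nt w-nt fx≤u) (f-reflect x′-nt w-nt fx′≤u))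
    ... | inj₂ (v , v-nb , refl) =
      f≤g-intro j-nt v-nb (join-cases (f≤g-cases x-nt v-nb fx≤u) (f≤g-cases x′-nt v-nb fx′≤u))
      where
      above-both : a₁ U.≤ v → a₂ U.≤ v →
                   ((x L.∨ x′) L.≤ c₁ × a₁ U.≤ v) ⊎ ((x L.∨ x′) L.≤ c₂ × a₂ U.≤ v)
      above-both a₁≤v a₂≤v = Data.Sum.map (_, a₁≤v) (_, a₂≤v) (below-c₁-or-c₂ j-nt)
      join-cases : (x L.≤ c₁ × a₁ U.≤ v) ⊎ (x L.≤ c₂ × a₂ U.≤ v) →
                   (x′ L.≤ c₁ × a₁ U.≤ v) ⊎ (x′ L.≤ c₂ × a₂ U.≤ v) →
                   ((x L.∨ x′) L.≤ c₁ × a₁ U.≤ v) ⊎ ((x L.∨ x′) L.≤ c₂ × a₂ U.≤ v)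
      join-cases (inj₁ (x≤c₁ , a₁≤v)) (inj₁ (x′≤c₁ , _))  = inj₁ (L.∨-least x≤c₁ x′≤c₁ , a₁≤v)
      join-cases (inj₂ (x≤c₂ , a₂≤v)) (inj₂ (x′≤c₂ , _))  = inj₂ (L.∨-least x≤c₂ x′≤c₂ , a₂≤v)
      join-cases (inj₁ (_ , a₁≤v))    (inj₂ (_ , a₂≤v))   = above-both a₁≤v a₂≤v
      join-cases (inj₂ (_ , a₂≤v))    (inj₁ (_ , a₁≤v))   = above-both a₁≤v a₂≤v

  g-∧ : ∀ {y y′} → NotBottom y → NotBottom y′ → NotBottom (y U.∧ y′) → g y S.∧ g y′ ≡ g (y U.∧ y′)
  g-∧ {y} {y′} y-nb y′-nb m-nb =
    S.glb⇒≡∧ (g-mono m-nb y-nb (U.x∧y≤x y y′)) (g-mono m-nb y′-nb (U.x∧y≤y y y′)) greatest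
    where
    greatest : ∀ u → u S.≤ g y → u S.≤ g y′ → u S.≤ g (y U.∧ y′)
    greatest u u≤gy u≤gy′ with cover u
    ... | inj₂ (v , v-nb , refl) =
      g-mono v-nb m-nb (U.∧-greatest (g-reflect v-nb y-nb u≤gy) (g-reflect v-nb y′-nb u≤gy′))
    ... | inj₁ (w , w-nt , refl) =
      f≤g-intro w-nt m-nb (meet-cases (f≤g-cases w-nt y-nb u≤gy) (f≤g-cases w-nt y′-nb u≤gy′))
      where
      below-both : w L.≤ c₁ → w L.≤ c₂ →
                   (w L.≤ c₁ × a₁ U.≤ (y U.∧ y′)) ⊎ (w L.≤ c₂ × a₂ U.≤ (y U.∧ y′))
      below-both w≤c₁ w≤c₂ = Data.Sum.map (w≤c₁ ,_) (w≤c₂ ,_) (above-a₁-or-a₂ m-nb)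
      meet-cases : (w L.≤ c₁ × a₁ U.≤ y) ⊎ (w L.≤ c₂ × a₂ U.≤ y) →
                   (w L.≤ c₁ × a₁ U.≤ y′) ⊎ (w L.≤ c₂ × a₂ U.≤ y′) →
                   (w L.≤ c₁ × a₁ U.≤ (y U.∧ y′)) ⊎ (w L.≤ c₂ × a₂ U.≤ (y U.∧ y′))
      meet-cases (inj₁ (w≤c₁ , a₁≤y)) (inj₁ (_ , a₁≤y′)) = inj₁ (w≤c₁ , U.∧-greatest a₁≤y a₁≤y′)
      meet-cases (inj₂ (w≤c₂ , a₂≤y)) (inj₂ (_ , a₂≤y′)) = inj₂ (w≤c₂ , U.∧-greatest a₂≤y a₂≤y′)
      meet-cases (inj₁ (w≤c₁ , _))    (inj₂ (w≤c₂ , _))   = below-both w≤c₁ w≤c₂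
      meet-cases (inj₂ (w≤c₂ , _))    (inj₁ (w≤c₁ , _))   = below-both w≤c₁ w≤c₂

  glued-atom : ∀ {c} → IsCoatom L c → Σ[ a ∈ Elt U ] (IsAtom U a × f c ≡ g a)
  glued-atom c-coatom with coatom-cases c-coatom
  ... | inj₁ refl = a₁ , a₁-atom , glue₁
  ... | inj₂ refl = a₂ , a₂-atom , glue₂

  coatoms-⋖-join : Semimodular U → ∀ {c c′} → c ≢ c′ → IsCoatom L c → IsCoatom L c′ →
                   f c S.⋖ (f c S.∨ f c′)
  coatoms-⋖-join smU {c} {c′} c≢c′ c-coatom c′-coatom
    with glued-atom c-coatom | glued-atom c′-coatom
  ... | a , a-atom , fc≡ga | a′ , a′-atom , fc′≡ga′ =
    subst₂ S._⋖_ (sym fc≡ga) (trans (sym (g-∨ a-nb a′-nb)) (cong₂ S._∨_ (sym fc≡ga) (sym fc′≡ga′)))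
      (g-preserves-⋖ a-nb (NotBottom-↑ a-nb (U.x≤x∨y a a′)) a⋖a∨a′)
    where
    a-nb = U.atom-¬bottom a-atom
    a′-nb = U.atom-¬bottom a′-atom
    a≢a′ : a ≢ a′
    a≢a′ refl =
      c≢c′ (f-injective (L.coatom-¬top c-coatom) (L.coatom-¬top c′-coatom) (trans fc≡ga (sym fc′≡ga′)))
    a⋖a∨a′ : a U.⋖ (a U.∨ a′)
    a⋖a∨a′ = proj₁ (smU a a′ (U.meet-of-atoms-⋖ a≢a′ a-atom a′-atom)
                       (subst (U._⋖ a′) (U.∧-comm a′ a) (U.meet-of-atoms-⋖ (a≢a′ ∘ sym) a′-atom a-atom)))

  upperCovering-on-F : Semimodular L → Semimodular U → ∀ {a b} → InF a → InF b →
                       (a S.∧ b) S.⋖ a → (a S.∧ b) S.⋖ b → a S.⋖ (a S.∨ b)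
  upperCovering-on-F smL smU (x , x-nt , refl) (x′ , x′-nt , refl) p q = by-cases (L.IsTop? (x L.∨ x′))
    where
    m-nt = NotTop-↓ x-nt (L.x∧y≤x x x′)
    m⋖x : (x L.∧ x′) L.⋖ x
    m⋖x = f-reflects-⋖ m-nt x-nt (subst (S._⋖ f x) (f-∧ x-nt x′-nt) p)
    m⋖x′ : (x L.∧ x′) L.⋖ x′
    m⋖x′ = f-reflects-⋖ m-nt x′-nt (subst (S._⋖ f x′) (f-∧ x-nt x′-nt) q)
    x⋖j : x L.⋖ (x L.∨ x′)
    x⋖j = proj₁ (smL x x′ m⋖x m⋖x′)
    x′⋖j : x′ L.⋖ (x L.∨ x′)
    x′⋖j = proj₂ (smL x x′ m⋖x m⋖x′)
    x≢x′ : x ≢ x′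
    x≢x′ refl = L.⋖-meetˡ⇒≰ m⋖x L.≤-refl
    by-cases : Dec (IsTop L (x L.∨ x′)) → f x S.⋖ (f x S.∨ f x′)
    by-cases (no j-nt)   = subst (f x S.⋖_) (sym (f-∨ x-nt x′-nt j-nt)) (f-preserves-⋖ x-nt j-nt x⋖j)
    by-cases (yes j-top) = coatoms-⋖-join smU x≢x′ (_ , j-top , x⋖j) (_ , j-top , x′⋖j)

  upperCovering-on-G : Semimodular U → ∀ {y y′} → NotBottom y → NotBottom y′ → NotBottom (y U.∧ y′) →
                       (g y S.∧ g y′) S.⋖ g y → (g y S.∧ g y′) S.⋖ g y′ → g y S.⋖ (g y S.∨ g y′)
  upperCovering-on-G smU {y} {y′} y-nb y′-nb m-nb p q =
    subst (g y S.⋖_) (sym (g-∨ y-nb y′-nb))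
      (g-preserves-⋖ y-nb (NotBottom-↑ y-nb (U.x≤x∨y y y′)) (proj₁ (smU y y′ m⋖y m⋖y′)))
    where
    m⋖y = g-reflects-⋖ m-nb y-nb (subst (S._⋖ g y) (g-∧ y-nb y′-nb m-nb) p)
    m⋖y′ = g-reflects-⋖ m-nb y′-nb (subst (S._⋖ g y′) (g-∧ y-nb y′-nb m-nb) q)

  -- The glued element f c = g a lies between f w and g y, so it is one of them.
  ⋖-through-glue : ∀ {w y c a} → NotTop w → NotBottom y → NotTop c → NotBottom a → f c ≡ g a →
                   w L.≤ c → a U.≤ y → f w S.⋖ g y → InG (f w) ⊎ InF (g y)
  ⋖-through-glue {w} {y} {c} {a} w-nt y-nb c-nt a-nb fc≡ga w≤c a≤y (_ , between)
    with between (g a) (subst (f w S.≤_) fc≡ga (f-mono w-nt c-nt w≤c)) (g-mono a-nb y-nb a≤y)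
  ... | inj₁ ga≡fw = inj₁ (a , a-nb , ga≡fw)
  ... | inj₂ ga≡gy = inj₂ (c , c-nt , trans fc≡ga ga≡gy)

  f⋖g⇒glued : ∀ {w y} → NotTop w → NotBottom y → f w S.⋖ g y → InG (f w) ⊎ InF (g y)
  f⋖g⇒glued w-nt y-nb fw⋖gy with f≤g-cases w-nt y-nb (proj₁ (proj₁ fw⋖gy))
  ... | inj₁ (w≤c₁ , a₁≤y) = ⋖-through-glue w-nt y-nb c₁-NotTop a₁-NotBottom glue₁ w≤c₁ a₁≤y fw⋖gy
  ... | inj₂ (w≤c₂ , a₂≤y) = ⋖-through-glue w-nt y-nb c₂-NotTop a₂-NotBottom glue₂ w≤c₂ a₂≤y fw⋖gy

  ⋖-F-and-G⇒F : ∀ {m a b} → m S.⋖ a → m S.⋖ b → InF a → InG b → InF b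
  ⋖-F-and-G⇒F ((m≤fx , m≢fx) , _) m⋖gy (x , x-nt , refl) (y , y-nb , refl)
    with InF-↓ (x , x-nt , refl) m≤fx
  ... | w , w-nt , refl with f⋖g⇒glued w-nt y-nb m⋖gy
  ...   | inj₂ gy∈F = gy∈F
  ...   | inj₁ (v , v-nb , gv≡fw) =
    ⊥-elim (m≢fx (trans (sym gv≡fw) (g≤f⇒≡ x-nt v-nb (subst (S._≤ f x) (sym gv≡fw) m≤fx))))

  InG-below-disjoint : ∀ {m y y′} → IsBottom U (y U.∧ y′) → NotBottom y → NotBottom y′ →
                       InG m → m S.≤ g y → m S.≤ g y′ → ⊥
  InG-below-disjoint y∧y′-bottom y-nb y′-nb (v , v-nb , refl) gv≤gy gv≤gy′ =
    v-nb (λ z → U.≤-trans (U.∧-greatest (g-reflect v-nb y-nb gv≤gy) (g-reflect v-nb y′-nb gv≤gy′))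
                          (y∧y′-bottom z))

  ⋖-G-disjoint⇒F : ∀ {m y y′} → IsBottom U (y U.∧ y′) → NotBottom y → NotBottom y′ →
                   m S.⋖ g y → m S.≤ g y′ → InF (g y)
  ⋖-G-disjoint⇒F {m} y∧y′-bottom y-nb y′-nb m⋖gy m≤gy′ with cover m
  ... | inj₂ m∈G =
    ⊥-elim (InG-below-disjoint y∧y′-bottom y-nb y′-nb m∈G (proj₁ (proj₁ m⋖gy)) m≤gy′)
  ... | inj₁ (w , w-nt , refl) with f⋖g⇒glued w-nt y-nb m⋖gy
  ...   | inj₂ gy∈F = gy∈F
  ...   | inj₁ fw∈G =
    ⊥-elim (InG-below-disjoint y∧y′-bottom y-nb y′-nb fw∈G (proj₁ (proj₁ m⋖gy)) m≤gy′)

  upperCovering-S : Semimodular L → Semimodular U → UpperCovering S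
  upperCovering-S smL smU a b p q with cover a | cover b
  ... | inj₁ a∈F | inj₁ b∈F = upperCovering-on-F smL smU a∈F b∈F p q
  ... | inj₁ a∈F | inj₂ b∈G =
    upperCovering-on-F smL smU a∈F (⋖-F-and-G⇒F p q a∈F b∈G) p q
  ... | inj₂ a∈G | inj₁ b∈F =
    upperCovering-on-F smL smU (⋖-F-and-G⇒F q p b∈F a∈G) b∈F p q
  ... | inj₂ (y , y-nb , refl) | inj₂ (y′ , y′-nb , refl) with U.IsBottom? (y U.∧ y′)
  ...   | no m-nb = upperCovering-on-G smU y-nb y′-nb m-nb p q
  ...   | yes m-bottom =
    upperCovering-on-F smL smU
      (⋖-G-disjoint⇒F m-bottom y-nb y′-nb p (S.x∧y≤y _ _))
      (⋖-G-disjoint⇒F (subst (IsBottom U) (U.∧-comm y y′) m-bottom) y′-nb y-nb q (S.x∧y≤x _ _)) p q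

  f-⋖-join : Semimodular S → ∀ {x x′} → NotTop x → NotTop x′ →
             (x L.∧ x′) L.⋖ x → (x L.∧ x′) L.⋖ x′ → f x S.⋖ (f x S.∨ f x′) × f x′ S.⋖ (f x S.∨ f x′)
  f-⋖-join smS {x} {x′} x-nt x′-nt m⋖x m⋖x′ =
    smS (f x) (f x′) (subst (S._⋖ f x) (sym (f-∧ x-nt x′-nt)) (f-preserves-⋖ m-nt x-nt m⋖x))
                     (subst (S._⋖ f x′) (sym (f-∧ x-nt x′-nt)) (f-preserves-⋖ m-nt x′-nt m⋖x′))
    where m-nt = NotTop-↓ x-nt (L.x∧y≤x x x′)

  g-⋖-join : Semimodular S → ∀ {y y′} → NotBottom y → NotBottom y′ → NotBottom (y U.∧ y′) →
             (y U.∧ y′) U.⋖ y → (y U.∧ y′) U.⋖ y′ → g y S.⋖ (g y S.∨ g y′) × g y′ S.⋖ (g y S.∨ g y′)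
  g-⋖-join smS {y} {y′} y-nb y′-nb m-nb m⋖y m⋖y′ =
    smS (g y) (g y′) (subst (S._⋖ g y) (sym (g-∧ y-nb y′-nb m-nb)) (g-preserves-⋖ m-nb y-nb m⋖y))
                     (subst (S._⋖ g y′) (sym (g-∧ y-nb y′-nb m-nb)) (g-preserves-⋖ m-nb y′-nb m⋖y′))

  top-join-not-below : ∀ {x x′ c} → IsTop L (x L.∨ x′) → NotTop c → x L.≤ c → x′ L.≤ c → ⊥
  top-join-not-below j-top c-nt x≤c x′≤c = c-nt (λ z → L.≤-trans (j-top z) (L.∨-least x≤c x′≤c))

  ⋖-top-join⇒coatom : ∀ {x x′ u} → NotTop x → NotTop x′ → IsTop L (x L.∨ x′) →
                      f x S.⋖ u → f x′ S.≤ u → IsCoatom L x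
  ⋖-top-join⇒coatom {x} {x′} {u} x-nt x′-nt j-top ((fx≤u , _) , between) fx′≤u =
    via (below-c₁-or-c₂ x-nt)
    where
    glued-below-u : f c₁ S.≤ u × f c₂ S.≤ u
    glued-below-u with cover u
    ... | inj₁ (w , w-nt , refl) =
      ⊥-elim (top-join-not-below j-top w-nt (f-reflect x-nt w-nt fx≤u) (f-reflect x′-nt w-nt fx′≤u))
    ... | inj₂ (v , v-nb , refl) = by-cases (f≤g-cases x-nt v-nb fx≤u) (f≤g-cases x′-nt v-nb fx′≤u)
      where
      above-both : a₁ U.≤ v → a₂ U.≤ v → f c₁ S.≤ g v × f c₂ S.≤ g v
      above-both a₁≤v a₂≤v = subst (S._≤ g v) (sym glue₁) (g-mono a₁-NotBottom v-nb a₁≤v) ,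
                             subst (S._≤ g v) (sym glue₂) (g-mono a₂-NotBottom v-nb a₂≤v)
      by-cases : (x L.≤ c₁ × a₁ U.≤ v) ⊎ (x L.≤ c₂ × a₂ U.≤ v) →
                 (x′ L.≤ c₁ × a₁ U.≤ v) ⊎ (x′ L.≤ c₂ × a₂ U.≤ v) → f c₁ S.≤ g v × f c₂ S.≤ g v
      by-cases (inj₁ (x≤c₁ , _)) (inj₁ (x′≤c₁ , _)) =
        ⊥-elim (top-join-not-below j-top c₁-NotTop x≤c₁ x′≤c₁)
      by-cases (inj₂ (x≤c₂ , _)) (inj₂ (x′≤c₂ , _)) =
        ⊥-elim (top-join-not-below j-top c₂-NotTop x≤c₂ x′≤c₂)
      by-cases (inj₁ (_ , a₁≤v)) (inj₂ (_ , a₂≤v)) = above-both a₁≤v a₂≤v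
      by-cases (inj₂ (_ , a₂≤v)) (inj₁ (_ , a₁≤v)) = above-both a₁≤v a₂≤v

    through : ∀ {c} → IsCoatom L c → NotTop c → x L.≤ c → f c S.≤ u → IsCoatom L x
    through c-coatom c-nt x≤c fc≤u with between _ (f-mono x-nt c-nt x≤c) fc≤u
    ... | inj₁ fc≡fx = subst (IsCoatom L) (f-injective c-nt x-nt fc≡fx) c-coatom
    ... | inj₂ fc≡u  = ⊥-elim (top-join-not-below j-top c-nt x≤c
                                 (f-reflect x′-nt c-nt (subst (f x′ S.≤_) (sym fc≡u) fx′≤u)))

    via : x L.≤ c₁ ⊎ x L.≤ c₂ → IsCoatom L x
    via (inj₁ x≤c₁) = through c₁-coatom c₁-NotTop x≤c₁ (proj₁ glued-below-u)
    via (inj₂ x≤c₂) = through c₂-coatom c₂-NotTop x≤c₂ (proj₂ glued-below-u)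

  upperCovering-L : Semimodular S → UpperCovering L
  upperCovering-L smS x x′ p q with L.IsTop? x | L.IsTop? x′
  ... | yes x-top | _          = ⊥-elim (L.⋖-meetʳ⇒≰ q (x-top x′))
  ... | no _      | yes x′-top = ⊥-elim (L.⋖-meetˡ⇒≰ p (x′-top x))
  ... | no x-nt   | no x′-nt   = by-cases (L.IsTop? (x L.∨ x′))
    where
    fx⋖J = proj₁ (f-⋖-join smS x-nt x′-nt p q)
    by-cases : Dec (IsTop L (x L.∨ x′)) → x L.⋖ (x L.∨ x′)
    by-cases (no j-nt)   = f-reflects-⋖ x-nt j-nt (subst (f x S.⋖_) (f-∨ x-nt x′-nt j-nt) fx⋖J)
    by-cases (yes j-top) =
      L.coatom-⋖-top (⋖-top-join⇒coatom x-nt x′-nt j-top fx⋖J (S.y≤x∨y _ _)) j-top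

  -- The covers u ≤ c₁ and v ≤ c₂ of c₁ ∧ c₂ join to 1, and f u, f v cover their join in S;
  -- this forces u and v to be coatoms, that is u = c₁ and v = c₂.
  glued-coatoms-⋖-join : Semimodular S → f c₁ S.⋖ (f c₁ S.∨ f c₂) × f c₂ S.⋖ (f c₁ S.∨ f c₂)
  glued-coatoms-⋖-join smS =
    subst₂ (λ c c′ → f c S.⋖ (f c S.∨ f c′) × f c′ S.⋖ (f c S.∨ f c′)) u≡c₁ v≡c₂ covers
    where
    m = c₁ L.∧ c₂
    not-below-m : ∀ {z} → m L.< z → z L.≤ c₁ → z L.≤ c₂ → ⊥
    not-below-m (m≤z , m≢z) z≤c₁ z≤c₂ = m≢z (L.antisym m≤z (L.∧-greatest z≤c₁ z≤c₂))
    m<c₁ : m L.< c₁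
    m<c₁ = L.x∧y≤x c₁ c₂ , λ m≡c₁ →
      L.coatoms-incomparable c₁≢c₂ c₁-coatom c₂-coatom (subst (L._≤ c₂) m≡c₁ (L.x∧y≤y c₁ c₂))
    m<c₂ : m L.< c₂
    m<c₂ = L.x∧y≤y c₁ c₂ , λ m≡c₂ →
      L.coatoms-incomparable (c₁≢c₂ ∘ sym) c₂-coatom c₁-coatom (subst (L._≤ c₁) m≡c₂ (L.x∧y≤x c₁ c₂))
    u-cover = L.cover-between m<c₁
    v-cover = L.cover-between m<c₂
    u = proj₁ u-cover
    v = proj₁ v-cover
    m⋖u = proj₁ (proj₂ u-cover)
    m⋖v = proj₁ (proj₂ v-cover)
    u≤c₁ = proj₂ (proj₂ u-cover)
    v≤c₂ = proj₂ (proj₂ v-cover)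
    u-nt = NotTop-↓ c₁-NotTop u≤c₁
    v-nt = NotTop-↓ c₂-NotTop v≤c₂
    u∧v≡m : u L.∧ v ≡ m
    u∧v≡m = L.antisym (L.∧-greatest (L.≤-trans (L.x∧y≤x u v) u≤c₁) (L.≤-trans (L.x∧y≤y u v) v≤c₂))
                      (L.∧-greatest (proj₁ (proj₁ m⋖u)) (proj₁ (proj₁ m⋖v)))
    covers : f u S.⋖ (f u S.∨ f v) × f v S.⋖ (f u S.∨ f v)
    covers = f-⋖-join smS u-nt v-nt (subst (L._⋖ u) (sym u∧v≡m) m⋖u) (subst (L._⋖ v) (sym u∧v≡m) m⋖v)
    j-top : IsTop L (u L.∨ v)
    j-top with L.IsTop? (u L.∨ v)
    ... | yes j-top = j-top
    ... | no j-nt with below-c₁-or-c₂ j-nt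
    ...   | inj₁ j≤c₁ = ⊥-elim (not-below-m (proj₁ m⋖v) (L.≤-trans (L.y≤x∨y u v) j≤c₁) v≤c₂)
    ...   | inj₂ j≤c₂ = ⊥-elim (not-below-m (proj₁ m⋖u) u≤c₁ (L.≤-trans (L.x≤x∨y u v) j≤c₂))
    u≡c₁ : u ≡ c₁
    u≡c₁ = sym (L.coatom-maximal (⋖-top-join⇒coatom u-nt v-nt j-top (proj₁ covers) (S.y≤x∨y _ _))
                                 c₁-NotTop u≤c₁)
    v≡c₂ : v ≡ c₂
    v≡c₂ = sym (L.coatom-maximal (⋖-top-join⇒coatom v-nt u-nt (subst (IsTop L) (L.∨-comm u v) j-top)
                                                     (proj₂ covers) (S.x≤x∨y _ _))
                                 c₂-NotTop v≤c₂)

  glued-atoms-⋖-join : Semimodular S → a₁ U.⋖ (a₁ U.∨ a₂) × a₂ U.⋖ (a₁ U.∨ a₂)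
  glued-atoms-⋖-join smS =
    g-reflects-⋖ a₁-NotBottom j-nb (subst₂ S._⋖_ glue₁ J≡g[a₁∨a₂] (proj₁ (glued-coatoms-⋖-join smS))) ,
    g-reflects-⋖ a₂-NotBottom j-nb (subst₂ S._⋖_ glue₂ J≡g[a₁∨a₂] (proj₂ (glued-coatoms-⋖-join smS)))
    where
    j-nb = NotBottom-↑ a₁-NotBottom (U.x≤x∨y a₁ a₂)
    J≡g[a₁∨a₂] : f c₁ S.∨ f c₂ ≡ g (a₁ U.∨ a₂)
    J≡g[a₁∨a₂] = trans (cong₂ S._∨_ glue₁ glue₂) (g-∨ a₁-NotBottom a₂-NotBottom)

  atoms-⋖-join : Semimodular S → ∀ {a a′} → a ≢ a′ → IsAtom U a → IsAtom U a′ → a U.⋖ (a U.∨ a′)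
  atoms-⋖-join smS a≢a′ a-atom a′-atom with atom-cases a-atom | atom-cases a′-atom
  ... | inj₁ refl | inj₁ refl = ⊥-elim (a≢a′ refl)
  ... | inj₂ refl | inj₂ refl = ⊥-elim (a≢a′ refl)
  ... | inj₁ refl | inj₂ refl = proj₁ (glued-atoms-⋖-join smS)
  ... | inj₂ refl | inj₁ refl = subst (a₂ U.⋖_) (U.∨-comm a₁ a₂) (proj₂ (glued-atoms-⋖-join smS))

  upperCovering-U : Semimodular S → UpperCovering U
  upperCovering-U smS y y′ p q with U.IsBottom? y | U.IsBottom? y′
  ... | yes y-bottom | _             = ⊥-elim (U.⋖-meetˡ⇒≰ p (y-bottom y′))
  ... | no _         | yes y′-bottom = ⊥-elim (U.⋖-meetʳ⇒≰ q (y′-bottom y))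
  ... | no y-nb      | no y′-nb      = by-cases (U.IsBottom? (y U.∧ y′))
    where
    y≢y′ : y ≢ y′
    y≢y′ refl = U.⋖-meetˡ⇒≰ p U.≤-refl
    by-cases : Dec (IsBottom U (y U.∧ y′)) → y U.⋖ (y U.∨ y′)
    by-cases (no m-nb)      =
      g-reflects-⋖ y-nb (NotBottom-↑ y-nb (U.x≤x∨y y y′))
        (subst (g y S.⋖_) (g-∨ y-nb y′-nb) (proj₁ (g-⋖-join smS y-nb y′-nb m-nb p q)))
    by-cases (yes m-bottom) = atoms-⋖-join smS y≢y′ (_ , m-bottom , p) (_ , m-bottom , q)

  cutPoint-L⇒S : ∀ {x} → IsCutPoint L x → IsCutPoint S (f x)
  cutPoint-L⇒S {x} cut = record
    { comparable = comparable′
    ; lower      = let z , z≤x , z≢x = IsCutPoint.lower cut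
                       z-nt = NotTop-↓ x-nt z≤x in
                   f z , f-mono z-nt x-nt z≤x , z≢x ∘ f-injective z-nt x-nt
    ; upper      = f c₁ , f-mono x-nt c₁-NotTop x≤c₁ , λ fx≡fc₁ →
                   L.coatoms-incomparable c₁≢c₂ c₁-coatom c₂-coatom
                     (subst (L._≤ c₂) (f-injective x-nt c₁-NotTop fx≡fc₁) x≤c₂)
    }
    where
    x-nt = cutPoint-¬top cut
    x≤c₁ = cutPoint-below-coatom cut c₁≢c₂ c₁-coatom c₂-coatom
    x≤c₂ = cutPoint-below-coatom cut (c₁≢c₂ ∘ sym) c₂-coatom c₁-coatom
    comparable′ : ∀ z → z S.≤ f x ⊎ f x S.≤ z
    comparable′ z with cover z
    ... | inj₁ (w , w-nt , refl) =
      Data.Sum.map (f-mono w-nt x-nt) (f-mono x-nt w-nt) (IsCutPoint.comparable cut w)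
    ... | inj₂ (v , v-nb , refl) =
      inj₂ (f≤g-intro x-nt v-nb (Data.Sum.map (x≤c₁ ,_) (x≤c₂ ,_) (above-a₁-or-a₂ v-nb)))

  cutPoint-U⇒S : ∀ {y} → IsCutPoint U y → IsCutPoint S (g y)
  cutPoint-U⇒S {y} cut = record
    { comparable = comparable′
    ; lower      = g a₁ , g-mono a₁-NotBottom y-nb a₁≤y , λ ga₁≡gy →
                   U.atoms-incomparable (a₁≢a₂ ∘ sym) a₂-atom a₁-atom
                     (subst (a₂ U.≤_) (sym (g-injective a₁-NotBottom y-nb ga₁≡gy)) a₂≤y)
    ; upper      = let z , y≤z , y≢z = IsCutPoint.upper cut
                       z-nb = NotBottom-↑ y-nb y≤z in
                   g z , g-mono y-nb z-nb y≤z , y≢z ∘ g-injective y-nb z-nb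
    }
    where
    y-nb = cutPoint-¬bottom cut
    a₁≤y = cutPoint-above-atom cut a₁≢a₂ a₁-atom a₂-atom
    a₂≤y = cutPoint-above-atom cut (a₁≢a₂ ∘ sym) a₂-atom a₁-atom
    comparable′ : ∀ z → z S.≤ g y ⊎ g y S.≤ z
    comparable′ z with cover z
    ... | inj₂ (v , v-nb , refl) =
      Data.Sum.map (g-mono v-nb y-nb) (g-mono y-nb v-nb) (IsCutPoint.comparable cut v)
    ... | inj₁ (w , w-nt , refl) =
      inj₁ (f≤g-intro w-nt y-nb (Data.Sum.map (_, a₁≤y) (_, a₂≤y) (below-c₁-or-c₂ w-nt)))

  cutPoint-S⇒L⊎U : ∀ {p} → IsCutPoint S p → Σ (Elt L) (IsCutPoint L) ⊎ Σ (Elt U) (IsCutPoint U)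
  cutPoint-S⇒L⊎U {p} cut with cover p
  ... | inj₁ (x , x-nt , refl) = inj₁ (x , record
    { comparable = comparable′
    ; lower      = let s , s≤fx , s≢fx = IsCutPoint.lower cut
                       w , w-nt , fw≡s = InF-↓ (x , x-nt , refl) s≤fx in
                   w , f-reflect w-nt x-nt (subst (S._≤ f x) (sym fw≡s) s≤fx) ,
                   λ w≡x → s≢fx (trans (sym fw≡s) (cong f w≡x))
    ; upper      = L.𝟙 , L.¬IsTop⇒<𝟙 x-nt
    })
    where
    comparable′ : ∀ z → z L.≤ x ⊎ x L.≤ z
    comparable′ z with L.IsTop? z
    ... | yes z-top = inj₂ (z-top x)
    ... | no z-nt   = Data.Sum.map (f-reflect z-nt x-nt) (f-reflect x-nt z-nt) (IsCutPoint.comparable cut (f z))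
  ... | inj₂ (y , y-nb , refl) = inj₂ (y , record
    { comparable = comparable′
    ; lower      = U.𝟘 , U.¬IsBottom⇒𝟘< y-nb
    ; upper      = let s , gy≤s , gy≢s = IsCutPoint.upper cut
                       v , v-nb , gv≡s = InG-↑ (y , y-nb , refl) gy≤s in
                   v , g-reflect y-nb v-nb (subst (g y S.≤_) (sym gv≡s) gy≤s) ,
                   λ y≡v → gy≢s (trans (cong g y≡v) gv≡s)
    })
    where
    comparable′ : ∀ z → z U.≤ y ⊎ y U.≤ z
    comparable′ z with U.IsBottom? z
    ... | yes z-bottom = inj₁ (z-bottom y)
    ... | no z-nb      = Data.Sum.map (g-reflect z-nb y-nb) (g-reflect y-nb z-nb) (IsCutPoint.comparable cut (g z))

lemma4 : TwoSummable SemimodularVI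
lemma4 = closed , inherited
  where
  closed : ∀ L U S → SemimodularVI L → SemimodularVI U → IsVertical2Sum S L U → SemimodularVI S
  closed L U S (smL , viL) (smU , viU) (_ , _ , _ , _ , _ , _ , V) =
    upperCovering⇒semimodular {S} (upperCovering-S smL smU) ,
    ¬cutPoint⇒IsVI λ p cut →
      Data.Sum.[ uncurry (IsVI⇒¬cutPoint viL) , uncurry (IsVI⇒¬cutPoint viU) ] (cutPoint-S⇒L⊎U cut)
    where open Vertical2Sum V

  inherited : ∀ S L U → SemimodularVI S → IsVertical2Sum S L U → SemimodularVI L × SemimodularVI U
  inherited S L U (smS , viS) (_ , _ , _ , _ , f , g , V) =
    (upperCovering⇒semimodular {L} (upperCovering-L smS) ,
     ¬cutPoint⇒IsVI λ x cut → IsVI⇒¬cutPoint viS (f x) (cutPoint-L⇒S cut)) ,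
    (upperCovering⇒semimodular {U} (upperCovering-U smS) ,
     ¬cutPoint⇒IsVI λ y cut → IsVI⇒¬cutPoint viS (g y) (cutPoint-U⇒S cut))
    where open Vertical2Sum V
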